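{- Let $\mathbb K$ be a field of characteristic $0$ and let $G=(V,E)$ be a simple connected undirected graph with $V=\{1,\dots,n\}$ and $|E|\ge 2$. If $r(G)=1$, then $G$ is articulated.
   Context: The graphic arrangement of $G$ is $\mathcal A(G)=\{V(x_i-x_j) : \{i,j\}\in E\}$ in $\mathbb K^n$. Let $W=\bigcap_{\{i,j\}\in E}\ker(x_i-x_j)$; the hyperplanes of $\mathcal A(G)$ induce an essential central arrangement $\bar{\mathcal A}$ in $\mathbb K^n/W$. With $F$ the defining polynomial of $\bar{\mathcal A}$ in linear coordinates $u_1,\dots,u_\ell$ of $\mathbb K^n/W$, $r(G)$ is the least $r$ such that there exist homogeneous polynomials $P_1,\dots,P_\ell$ of degree $r$, not all zero, with $\sum_k P_k\,\partial F/\partial u_k=0$. The graph $G$ is articulated if it is connected and has a vertex $v$ such that $G-\{v\}$ is disconnected. -}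

module Defs where

open import Level using (Level; _⊔_) renaming (suc to lsuc)
open import Algebra.Bundles using (CommutativeRing)
open import Data.Bool using (Bool; true; false; _∧_; if_then_else_)
open import Data.Nat as ℕ using (ℕ; zero; suc; pred; _<_; _<ᵇ_)
open import Data.Fin using (Fin; zero; suc; toℕ)
open import Data.List using (List; []; _∷_; [_]; _++_; map; concatMap; foldr; length; filterᵇ; cartesianProduct; allFin)
open import Data.Vec using (Vec; replicate; zipWith; lookup; updateAt; sum)
open import Data.Vec.Properties using (≡-dec)
open import Data.Product using (Σ; ∃; ∃-syntax; _×_; _,_)
open import Data.Unit using (⊤)
open import Relation.Nullary using (¬_; does)
open import Relation.Binary.PropositionalEquality using (_≡_; _≢_)

record Field c ℓ : Set (lsuc (c ⊔ ℓ)) where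
  field
    commutativeRing : CommutativeRing c ℓ
  open CommutativeRing commutativeRing public
  field
    0≉1     : ¬ (0# ≈ 1#)
    inverse : ∀ x → ¬ (x ≈ 0#) → ∃ λ y → (x * y) ≈ 1#

record SimpleGraph (n : ℕ) : Set where
  field
    Adj    : Fin n → Fin n → Bool
    sym    : ∀ i j → Adj i j ≡ Adj j i
    irrefl : ∀ i → Adj i i ≡ false
open SimpleGraph public

edges : ∀ {n} → SimpleGraph n → List (Fin n × Fin n)
edges {n} G = filterᵇ (λ { (i , j) → (toℕ i <ᵇ toℕ j) ∧ Adj G i j })
                      (cartesianProduct (allFin n) (allFin n))

-- walks in G all of whose vertices satisfy S (S = vertices of an induced subgraph)
data Walk {n} (G : SimpleGraph n) (S : Fin n → Set) : Fin n → Fin n → Set where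
  here : ∀ {a} → S a → Walk G S a a
  step : ∀ {a b c} → S a → Adj G a b ≡ true → Walk G S b c → Walk G S a c

Connected : ∀ {n} → SimpleGraph n → Set
Connected G = ∀ a b → Walk G (λ _ → ⊤) a b

DisconnectedWithout : ∀ {n} → SimpleGraph n → Fin n → Set
DisconnectedWithout G v =
  ∃[ a ] ∃[ b ] (a ≢ v × b ≢ v × ¬ Walk G (λ x → x ≢ v) a b)

Articulated : ∀ {n} → SimpleGraph n → Set
Articulated G = Connected G × ∃[ v ] DisconnectedWithout G v

-- Polynomials over a field K in m variables, as finite lists of terms
-- (coefficient , exponent vector); equality is coefficientwise.

module Polynomials {c ℓ} (K : Field c ℓ) where
  open Field K

  Poly : ℕ → Set c
  Poly m = List (Carrier × Vec ℕ m)

  natK : ℕ → Carrier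
  natK zero    = 0#
  natK (suc k) = 1# + natK k

  CharZero : Set ℓ
  CharZero = ∀ k → ¬ (natK (suc k) ≈ 0#)

  coeff : ∀ {m} → Poly m → Vec ℕ m → Carrier
  coeff []             e = 0#
  coeff ((a , f) ∷ p)  e =
    if does (≡-dec ℕ._≟_ f e) then a + coeff p e else coeff p e

  IsZero : ∀ {m} → Poly m → Set ℓ
  IsZero p = ∀ e → coeff p e ≈ 0#

  Homogeneous : ∀ {m} → ℕ → Poly m → Set ℓ
  Homogeneous r p = ∀ e → ¬ (sum e ≡ r) → coeff p e ≈ 0#

  zeroP : ∀ {m} → Poly m
  zeroP = []

  oneP : ∀ {m} → Poly m
  oneP {m} = [ (1# , replicate m 0) ]

  var : ∀ {m} → Fin m → Poly m
  var {m} k = [ (1# , updateAt (replicate m 0) k suc) ]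

  _⊕_ : ∀ {m} → Poly m → Poly m → Poly m
  p ⊕ q = p ++ q

  ⊖_ : ∀ {m} → Poly m → Poly m
  ⊖ p = map (λ { (a , e) → (- a , e) }) p

  _⊗_ : ∀ {m} → Poly m → Poly m → Poly m
  p ⊗ q = concatMap (λ { (a , e) → map (λ { (b , f) → (a * b , zipWith ℕ._+_ e f) }) q }) p

  prodP : ∀ {m} → List (Poly m) → Poly m
  prodP = foldr _⊗_ oneP

  sumP : ∀ {m} → List (Poly m) → Poly m
  sumP = foldr _⊕_ zeroP

  ∂ : ∀ {m} → Fin m → Poly m → Poly m
  ∂ k p = map (λ { (a , e) → (natK (lookup e k) * a , updateAt e k pred) }) p

  -- For connected G on n vertices,
  -- W = K·(1,…,1), and u_k = x_{k+1} - x_0 (k = 0,…,n-2) are linear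
  -- coordinates on K^n / W.  xform i is x_i written in these coordinates.

  xform : ∀ {n} → Fin n → Poly (pred n)
  xform {suc m} zero    = zeroP
  xform {suc m} (suc k) = var k

  definingPoly : ∀ {n} → SimpleGraph n → Poly (pred n)
  definingPoly G = prodP (map (λ { (i , j) → xform i ⊕ (⊖ xform j) }) (edges G))

  HasSyzygy : ∀ {n} → SimpleGraph n → ℕ → Set (c ⊔ ℓ)
  HasSyzygy {n} G r =
    Σ (Fin (pred n) → Poly (pred n)) λ P →
        (∀ k → Homogeneous r (P k))
      × ¬ (∀ k → IsZero (P k))
      × IsZero (sumP (map (λ k → P k ⊗ ∂ k (definingPoly G)) (allFin (pred n))))

  r[_]≡_ : ∀ {n} → SimpleGraph n → ℕ → Set (c ⊔ ℓ)
  r[ G ]≡ s = HasSyzygy G s × (∀ r → r < s → ¬ HasSyzygy G r)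

module Submission where

-- Cut vertices are decidable, so assume every G - {v} is connected.  Evaluated at a point x,
-- the syzygy becomes the Leibniz sum  Σ_e τ_e ∏_{e' ≠ e} α_e' = 0,  with α_ij = x_i - x_j and
-- τ_ij = T_i - T_j for the linear forms T_v = P_v (T_0 = 0, x_0 = 0).  At integer test points
-- where the factor of the edge ij is the only one to vanish, τ_ij vanishes; suitable such
-- points show that T_i and T_j have equal coefficients off {i, j} and satisfy one relation on
-- {i, j}.  Propagated along walks in G - {c} and G - {0}, this gives T_v = λ x_v for all v,
-- and Euler's identity  Σ_e λ α_e ∏_{e' ≠ e} α_e' = |E| λ F  then forces λ = 0, i.e. P = 0.

open import Defs renaming (sym to Adj-sym)
open import Algebra.Bundles using (CommutativeRing)
import Algebra.Solver.Ring
import Algebra.Solver.Ring.AlmostCommutativeRing as ACR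
open import Data.Bool using (Bool; true; false; if_then_else_)
open import Data.Bool.Properties using (T-∧; T-≡) renaming (_≟_ to _≟ᵇ_)
open import Data.Empty using (⊥; ⊥-elim)
open import Data.Fin as Fin using (Fin; zero; suc; toℕ)
import Data.Fin.Properties as Fin
open import Data.Fin.Subset using (∣_∣; ⊤; ⁅_⁆) renaming (_∈_ to _∈ₛ_; _-_ to _∖_)
open import Data.Fin.Subset.Properties using (_∈?_; ∈⊤; x∈p∧x≢y⇒x∈p-y; x∈p⇒∣p-x∣<∣p∣; p─q⊆p)
open import Data.Integer as ℤ using (ℤ; +_; -[1+_]; +[1+_]; _◃_)
import Data.Integer.Properties as ℤ
open import Data.List as List using (List; []; _∷_; _++_; allFin; length)
import Data.List.Properties as List
open import Data.List.Membership.Propositional using (_∈_)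
open import Data.List.Membership.Propositional.Properties using (∈-filter⁺; ∈-filter⁻; ∈-cartesianProduct⁺; ∈-allFin)
open import Data.List.Relation.Unary.Any using (here; there)
open import Data.List.Relation.Unary.All as All using (All; []; _∷_)
open import Data.List.Relation.Unary.AllPairs using ([]; _∷_)
open import Data.List.Relation.Unary.Unique.Propositional using (Unique)
import Data.List.Relation.Unary.Unique.Propositional.Properties as Unique
open import Data.Maybe using (Maybe; just; nothing)
open import Data.Nat as ℕ using (ℕ; zero; suc; pred; _<_; _≤_; z≤n; s≤s; ⌊_/2⌋)
import Data.Nat.Properties as ℕₚ
open import Data.Product using (_,_; _×_; Σ; ∃-syntax; proj₁; proj₂)
open import Data.Sign as Sign using (Sign)
open import Data.Sum using (_⊎_; inj₁; inj₂)
open import Data.Vec as Vec using (Vec; []; _∷_; lookup; updateAt; zipWith; replicate)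
import Data.Vec.Properties as Vec
open import Data.Vec.Properties using (≡-dec; lookup-replicate; ∷-injectiveʳ)
open import Function using (_∘_)
open import Function.Bundles using (Equivalence)
open import Relation.Binary.Definitions using (tri<; tri≈; tri>)
open import Relation.Binary.PropositionalEquality as ≡ using (_≡_; _≢_)
open import Relation.Nullary using (¬_; Dec; does; yes; no; _×-dec_; ¬?)
open import Relation.Nullary.Decidable using (dec-true; dec-false; decidable-stable)

module IntegerRingSolver {c ℓ} (K : Field c ℓ) where
  open Field K hiding (zero)
  open import Algebra.Properties.Ring ring using (-‿involutive; -0#≈0#; -‿distribˡ-*; -‿+-comm)
  open import Algebra.Properties.CommutativeSemigroup *-commutativeSemigroup using (interchange)
  open import Algebra.Properties.Semiring.Mult.TCOptimised semiring
    using (×-homo-+; ×1-homo-*) renaming (_×_ to _⋆_)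
  open import Relation.Binary.Reasoning.Setoid setoid

  -- The canonical map ℤ → K, built from the n-fold sums n ⋆ 1# (optimised so that
  -- 1 ⋆ 1# is 1# on the nose, as the solver requires of the constant 1).
  ι : ℤ → Carrier
  ι (+ n)    = n ⋆ 1#
  ι -[1+ n ] = - (suc n ⋆ 1#)

  ⋆-suc : ∀ n → suc n ⋆ 1# ≈ 1# + n ⋆ 1#
  ⋆-suc n = ×-homo-+ 1# 1 n

  -- Multiplicativity of ι is proved through the sign–magnitude form of integers.
  σ : Sign → Carrier
  σ Sign.+ = 1#
  σ Sign.- = - 1#

  σ-* : ∀ s t → σ (s Sign.* t) ≈ σ s * σ t
  σ-* Sign.- Sign.- = sym (trans (sym (-‿distribˡ-* 1# (- 1#))) (trans (-‿cong (*-identityˡ _)) (-‿involutive _)))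
  σ-* Sign.- Sign.+ = sym (*-identityʳ _)
  σ-* Sign.+ _      = sym (*-identityˡ _)

  ι-◃ : ∀ s n → ι (s ◃ n) ≈ σ s * (n ⋆ 1#)
  ι-◃ s       zero    = sym (zeroʳ _)
  ι-◃ Sign.+ (suc n) = sym (*-identityˡ _)
  ι-◃ Sign.- (suc n) = trans (-‿cong (sym (*-identityˡ _))) (-‿distribˡ-* 1# _)

  ι-sign : ∀ i → ι i ≈ σ (ℤ.sign i) * (ℤ.∣ i ∣ ⋆ 1#)
  ι-sign i = trans (reflexive (≡.cong ι (≡.sym (ℤ.◃-inverse i)))) (ι-◃ (ℤ.sign i) ℤ.∣ i ∣)

  ι-* : ∀ i j → ι (i ℤ.* j) ≈ ι i * ι j
  ι-* i j = begin
    ι ((sᵢ Sign.* sⱼ) ◃ (∣i∣ ℕ.* ∣j∣))           ≈⟨ ι-◃ (sᵢ Sign.* sⱼ) (∣i∣ ℕ.* ∣j∣) ⟩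
    σ (sᵢ Sign.* sⱼ) * ((∣i∣ ℕ.* ∣j∣) ⋆ 1#)      ≈⟨ *-cong (σ-* sᵢ sⱼ) (×1-homo-* ∣i∣ ∣j∣) ⟩
    (σ sᵢ * σ sⱼ) * (∣i∣ ⋆ 1# * ∣j∣ ⋆ 1#)        ≈⟨ interchange (σ sᵢ) (σ sⱼ) _ _ ⟩
    (σ sᵢ * ∣i∣ ⋆ 1#) * (σ sⱼ * ∣j∣ ⋆ 1#)        ≈⟨ *-cong (ι-sign i) (ι-sign j) ⟨
    ι i * ι j                                     ∎
    where
    sᵢ sⱼ : Sign
    sᵢ = ℤ.sign i
    sⱼ = ℤ.sign j
    ∣i∣ ∣j∣ : ℕ
    ∣i∣ = ℤ.∣ i ∣
    ∣j∣ = ℤ.∣ j ∣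

  ι-⊖ : ∀ m n → ι (m ℤ.⊖ n) ≈ m ⋆ 1# - n ⋆ 1#
  ι-⊖ zero    zero    = sym (trans (+-identityˡ _) -0#≈0#)
  ι-⊖ zero    (suc n) = sym (+-identityˡ _)
  ι-⊖ (suc m) zero    = sym (trans (+-congˡ -0#≈0#) (+-identityʳ _))
  ι-⊖ (suc m) (suc n) = begin
    ι (suc m ℤ.⊖ suc n)                       ≡⟨ ≡.cong ι (ℤ.[1+m]⊖[1+n]≡m⊖n m n) ⟩
    ι (m ℤ.⊖ n)                               ≈⟨ ι-⊖ m n ⟩
    m ⋆ 1# - n ⋆ 1#                           ≈⟨ cancel-1# (m ⋆ 1#) (n ⋆ 1#) ⟨
    (1# + m ⋆ 1#) - (1# + n ⋆ 1#)             ≈⟨ +-cong (⋆-suc m) (-‿cong (⋆-suc n)) ⟨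
    suc m ⋆ 1# - suc n ⋆ 1#                   ∎
    where
    cancel-1# : ∀ a b → (1# + a) - (1# + b) ≈ a - b
    cancel-1# a b = begin
      (1# + a) + - (1# + b)   ≈⟨ +-congˡ (-‿+-comm 1# b) ⟨
      (1# + a) + (- 1# + - b) ≈⟨ +-congʳ (+-comm 1# a) ⟩
      (a + 1#) + (- 1# + - b) ≈⟨ +-assoc a 1# _ ⟩
      a + (1# + (- 1# + - b)) ≈⟨ +-congˡ (+-assoc 1# (- 1#) (- b)) ⟨
      a + ((1# - 1#) + - b)   ≈⟨ +-congˡ (trans (+-congʳ (-‿inverseʳ 1#)) (+-identityˡ _)) ⟩
      a - b                   ∎

  ι-+ : ∀ i j → ι (i ℤ.+ j) ≈ ι i + ι j
  ι-+ -[1+ m ] -[1+ n ] = begin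
    - (suc (suc (m ℕ.+ n)) ⋆ 1#)       ≡⟨ ≡.cong (λ k → - (suc k ⋆ 1#)) (ℕₚ.+-suc m n) ⟨
    - ((suc m ℕ.+ suc n) ⋆ 1#)         ≈⟨ -‿cong (×-homo-+ 1# (suc m) (suc n)) ⟩
    - (suc m ⋆ 1# + suc n ⋆ 1#)        ≈⟨ -‿+-comm _ _ ⟨
    - (suc m ⋆ 1#) + - (suc n ⋆ 1#)    ∎
  ι-+ -[1+ m ] (+ n)    = trans (ι-⊖ n (suc m)) (+-comm _ _)
  ι-+ (+ m)    -[1+ n ] = ι-⊖ m (suc n)
  ι-+ (+ m)    (+ n)    = ×-homo-+ 1# m n

  ι-neg : ∀ i → ι (ℤ.- i) ≈ - ι i
  ι-neg (+ zero)  = sym -0#≈0#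
  ι-neg +[1+ n ]  = refl
  ι-neg -[1+ n ]  = sym (-‿involutive _)

  private
    almostCommutativeRing : ACR.AlmostCommutativeRing c ℓ
    almostCommutativeRing = ACR.fromCommutativeRing commutativeRing

    ι-morphism : ℤ.+-*-rawRing ACR.-Raw-AlmostCommutative⟶ almostCommutativeRing
    ι-morphism = record
      { ⟦_⟧ = ι ; +-homo = ι-+ ; *-homo = ι-* ; -‿homo = ι-neg ; 0-homo = refl ; 1-homo = refl }

    ι-equal? : ∀ i j → Maybe (ι i ≈ ι j)
    ι-equal? i j with i ℤ.≟ j
    ... | yes ≡.refl = just refl
    ... | no _       = nothing

  open Algebra.Solver.Ring ℤ.+-*-rawRing almostCommutativeRing ι-morphism ι-equal? public
    using (solve; _:=_; _:+_; _:*_; _:-_; :-_; con)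

module FiniteSums {c ℓ} (R : CommutativeRing c ℓ) where
  open CommutativeRing R hiding (zero)
  open import Algebra.Properties.Semiring.Sum semiring public
    using (sum; sum-syntax; sum-cong-≋; ∑-distrib-+; sum-replicate-zero; *-distribˡ-sum; *-distribʳ-sum)
  open import Algebra.Properties.Ring ring using (-0#≈0#; -‿+-comm)

  -- Kronecker delta, by recursion so that δ (suc k) (suc j) is δ k j
  δ : ∀ {m} → Fin m → Fin m → Carrier
  δ zero    zero    = 1#
  δ zero    (suc j) = 0#
  δ (suc k) zero    = 0#
  δ (suc k) (suc j) = δ k j

  δ-same : ∀ {m} (k : Fin m) → δ k k ≈ 1#
  δ-same zero    = refl
  δ-same (suc k) = δ-same k

  δ-distinct : ∀ {m} (k j : Fin m) → k ≢ j → δ k j ≈ 0#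
  δ-distinct zero    zero    k≢j = ⊥-elim (k≢j ≡.refl)
  δ-distinct zero    (suc j) k≢j = refl
  δ-distinct (suc k) zero    k≢j = refl
  δ-distinct (suc k) (suc j) k≢j = δ-distinct k j (k≢j ∘ ≡.cong suc)

  ∑-δ : ∀ {m} (f : Fin m → Carrier) (j : Fin m) → ∑[ l < m ] (f l * δ l j) ≈ f j
  ∑-δ {suc m} f zero =
    trans (+-cong (*-identityʳ _) (trans (sum-cong-≋ (λ l → zeroʳ (f (suc l)))) (sum-replicate-zero m)))
          (+-identityʳ _)
  ∑-δ {suc m} f (suc j) = trans (+-cong (zeroʳ _) (∑-δ (f ∘ suc) j)) (+-identityˡ _)

  ∑-distrib-neg : ∀ {m} (f : Fin m → Carrier) → ∑[ l < m ] (- f l) ≈ - ∑[ l < m ] f l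
  ∑-distrib-neg {zero}  f = sym -0#≈0#
  ∑-distrib-neg {suc m} f = trans (+-congˡ (∑-distrib-neg (f ∘ suc))) (-‿+-comm _ _)

  ∑-distrib-− : ∀ {m} (f g : Fin m → Carrier) → ∑[ l < m ] (f l - g l) ≈ ∑[ l < m ] f l - ∑[ l < m ] g l
  ∑-distrib-− f g = trans (∑-distrib-+ f (λ l → - g l)) (+-congˡ (∑-distrib-neg g))

module Evaluation {c ℓ} (K : Field c ℓ) where
  open Field K hiding (zero)
  open Polynomials K
  open IntegerRingSolver K
  open FiniteSums commutativeRing
  open import Algebra.Properties.Ring ring using (-0#≈0#; -‿distribˡ-*; -‿+-comm)
  open import Algebra.Properties.Semiring.Exp semiring using (_^_; ^-homo-*)
  open import Algebra.Properties.CommutativeSemigroup *-commutativeSemigroup using (interchange)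
  open import Relation.Binary.Reasoning.Setoid setoid

  Point : ℕ → Set c
  Point m = Vec Carrier m

  Term : ℕ → Set c
  Term m = Carrier × Vec ℕ m

  monomial : ∀ {m} → Vec ℕ m → Point m → Carrier
  monomial []      []       = 1#
  monomial (d ∷ e) (y ∷ ys) = y ^ d * monomial e ys

  evalTerm : ∀ {m} → Term m → Point m → Carrier
  evalTerm (a , e) x = a * monomial e x

  eval : ∀ {m} → Poly m → Point m → Carrier
  eval []      x = 0#
  eval (t ∷ p) x = evalTerm t x + eval p x

  natK-+ : ∀ a b → natK (a ℕ.+ b) ≈ natK a + natK b
  natK-+ zero    b = sym (+-identityˡ _)
  natK-+ (suc a) b = trans (+-congˡ (natK-+ a b)) (sym (+-assoc _ _ _))

  eval-⊕ : ∀ {m} (p q : Poly m) x → eval (p ⊕ q) x ≈ eval p x + eval q x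
  eval-⊕ []      q x = sym (+-identityˡ _)
  eval-⊕ (t ∷ p) q x = trans (+-congˡ (eval-⊕ p q x)) (sym (+-assoc _ _ _))

  eval-⊖ : ∀ {m} (p : Poly m) x → eval (⊖ p) x ≈ - eval p x
  eval-⊖ []            x = sym -0#≈0#
  eval-⊖ ((a , e) ∷ p) x =
    trans (+-cong (sym (-‿distribˡ-* a _)) (eval-⊖ p x)) (-‿+-comm _ _)

  eval-map : ∀ {m} (g : Term m → Term m) k (q : Poly m) x →
             (∀ t → evalTerm (g t) x ≈ k * evalTerm t x) → eval (List.map g q) x ≈ k * eval q x
  eval-map g k []      x hyp = sym (zeroʳ _)
  eval-map g k (t ∷ q) x hyp = trans (+-cong (hyp t) (eval-map g k q x hyp)) (sym (distribˡ _ _ _))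

  monomial-zip : ∀ {m} (e f : Vec ℕ m) x → monomial (zipWith ℕ._+_ e f) x ≈ monomial e x * monomial f x
  monomial-zip []      []      []       = sym (*-identityˡ _)
  monomial-zip (d ∷ e) (d' ∷ f) (y ∷ ys) = begin
    y ^ (d ℕ.+ d') * monomial (zipWith ℕ._+_ e f) ys         ≈⟨ *-cong (^-homo-* y d d') (monomial-zip e f ys) ⟩
    (y ^ d * y ^ d') * (monomial e ys * monomial f ys)      ≈⟨ interchange _ _ _ _ ⟩
    (y ^ d * monomial e ys) * (y ^ d' * monomial f ys)      ∎

  eval-⊗ : ∀ {m} (p q : Poly m) x → eval (p ⊗ q) x ≈ eval p x * eval q x
  eval-⊗ []            q x = sym (zeroˡ _)
  eval-⊗ ((a , e) ∷ p) q x = begin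
    eval (List.map _ q ++ p ⊗ q) x               ≈⟨ eval-⊕ (List.map _ q) (p ⊗ q) x ⟩
    eval (List.map _ q) x + eval (p ⊗ q) x       ≈⟨ +-cong (eval-map _ (a * monomial e x) q x λ { (b , f) → term b f })
                                                              (eval-⊗ p q x) ⟩
    (a * monomial e x) * eval q x + eval p x * eval q x ≈⟨ distribʳ _ _ _ ⟨
    (a * monomial e x + eval p x) * eval q x     ∎
    where
    term : ∀ b f → (a * b) * monomial (zipWith ℕ._+_ e f) x ≈ (a * monomial e x) * (b * monomial f x)
    term b f = trans (*-congˡ (monomial-zip e f x)) (interchange _ _ _ _)

  ∂monomial : ∀ {m} → Fin m → Vec ℕ m → Point m → Carrier
  ∂monomial k e x = natK (lookup e k) * monomial (updateAt e k pred) x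

  evalTerm∂ : ∀ {m} → Fin m → Term m → Point m → Carrier
  evalTerm∂ k (a , e) x = a * ∂monomial k e x

  eval∂ : ∀ {m} → Fin m → Poly m → Point m → Carrier
  eval∂ k []      x = 0#
  eval∂ k (t ∷ p) x = evalTerm∂ k t x + eval∂ k p x

  eval-∂ : ∀ {m} (k : Fin m) p x → eval (∂ k p) x ≈ eval∂ k p x
  eval-∂ k []            x = refl
  eval-∂ k ((a , e) ∷ p) x =
    +-cong (solve 3 (λ n a u → (n :* a) :* u := a :* (n :* u)) refl _ _ _) (eval-∂ k p x)

  ∂power : Carrier → ℕ → Carrier
  ∂power y d = natK d * y ^ pred d

  ∂power-+ : ∀ y d d' → ∂power y (d ℕ.+ d') ≈ ∂power y d * y ^ d' + y ^ d * ∂power y d'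
  ∂power-+ y zero d' =
    solve 3 (λ n u v → n :* u := (con (+ 0) :* con (+ 1)) :* v :+ con (+ 1) :* (n :* u)) refl _ _ _
  ∂power-+ y (suc a) zero rewrite ℕₚ.+-identityʳ a =
    solve 3 (λ n u v → n :* u := (n :* u) :* con (+ 1) :+ v :* (con (+ 0) :* con (+ 1))) refl _ _ _
  ∂power-+ y (suc a) (suc b) = begin
    (1# + natK (a ℕ.+ suc b)) * y ^ (a ℕ.+ suc b)
      ≈⟨ *-cong (+-congˡ (natK-+ a (suc b))) (^-homo-* y a (suc b)) ⟩
    (1# + (natK a + (1# + natK b))) * (y ^ a * (y * y ^ b))
      ≈⟨ solve 5 (λ A B U Y V → (con (+ 1) :+ (A :+ (con (+ 1) :+ B))) :* (U :* (Y :* V)) :=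
                   ((con (+ 1) :+ A) :* U) :* (Y :* V) :+ (Y :* U) :* ((con (+ 1) :+ B) :* V))
                 refl _ _ _ _ _ ⟩
    ((1# + natK a) * y ^ a) * (y * y ^ b) + (y * y ^ a) * ((1# + natK b) * y ^ b) ∎

  ∂monomial-suc : ∀ {m} (k : Fin m) d e y ys → ∂monomial (suc k) (d ∷ e) (y ∷ ys) ≈ y ^ d * ∂monomial k e ys
  ∂monomial-suc k d e y ys = solve 3 (λ a b c → a :* (b :* c) := b :* (a :* c)) refl _ _ _

  ∂monomial-zip : ∀ {m} (k : Fin m) (e f : Vec ℕ m) x →
    ∂monomial k (zipWith ℕ._+_ e f) x ≈ ∂monomial k e x * monomial f x + monomial e x * ∂monomial k f x
  ∂monomial-zip zero (d ∷ e) (d' ∷ f) (y ∷ ys) = begin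
    natK (d ℕ.+ d') * (y ^ pred (d ℕ.+ d') * monomial (zipWith ℕ._+_ e f) ys)
      ≈⟨ trans (sym (*-assoc _ _ _)) (*-cong (∂power-+ y d d') (monomial-zip e f ys)) ⟩
    (∂power y d * y ^ d' + y ^ d * ∂power y d') * (monomial e ys * monomial f ys)
      ≈⟨ solve 8 (λ A Q P D B Q' U V → ((A :* Q) :* P :+ D :* (B :* Q')) :* (U :* V) :=
                   (A :* (Q :* U)) :* (P :* V) :+ (D :* U) :* (B :* (Q' :* V)))
                 refl _ _ _ _ _ _ _ _ ⟩
    ∂monomial zero (d ∷ e) (y ∷ ys) * monomial (d' ∷ f) (y ∷ ys)
      + monomial (d ∷ e) (y ∷ ys) * ∂monomial zero (d' ∷ f) (y ∷ ys) ∎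
  ∂monomial-zip (suc k) (d ∷ e) (d' ∷ f) (y ∷ ys) = begin
    ∂monomial (suc k) (d ℕ.+ d' ∷ zipWith ℕ._+_ e f) (y ∷ ys)
      ≈⟨ ∂monomial-suc k (d ℕ.+ d') (zipWith ℕ._+_ e f) y ys ⟩
    y ^ (d ℕ.+ d') * ∂monomial k (zipWith ℕ._+_ e f) ys
      ≈⟨ *-cong (^-homo-* y d d') (∂monomial-zip k e f ys) ⟩
    (y ^ d * y ^ d') * (∂monomial k e ys * monomial f ys + monomial e ys * ∂monomial k f ys)
      ≈⟨ solve 6 (λ P P' De F E Df → (P :* P') :* (De :* F :+ E :* Df) :=
                   (P :* De) :* (P' :* F) :+ (P :* E) :* (P' :* Df))
                 refl _ _ _ _ _ _ ⟩
    (y ^ d * ∂monomial k e ys) * (y ^ d' * monomial f ys)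
      + (y ^ d * monomial e ys) * (y ^ d' * ∂monomial k f ys)
      ≈⟨ +-cong (*-congʳ (∂monomial-suc k d e y ys)) (*-congˡ (∂monomial-suc k d' f y ys)) ⟨
    ∂monomial (suc k) (d ∷ e) (y ∷ ys) * monomial (d' ∷ f) (y ∷ ys)
      + monomial (d ∷ e) (y ∷ ys) * ∂monomial (suc k) (d' ∷ f) (y ∷ ys) ∎

  eval∂-⊕ : ∀ {m} (k : Fin m) (p q : Poly m) x → eval∂ k (p ⊕ q) x ≈ eval∂ k p x + eval∂ k q x
  eval∂-⊕ k []      q x = sym (+-identityˡ _)
  eval∂-⊕ k (t ∷ p) q x = trans (+-congˡ (eval∂-⊕ k p q x)) (sym (+-assoc _ _ _))

  eval∂-⊖ : ∀ {m} (k : Fin m) (p : Poly m) x → eval∂ k (⊖ p) x ≈ - eval∂ k p x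
  eval∂-⊖ k []            x = sym -0#≈0#
  eval∂-⊖ k ((a , e) ∷ p) x =
    trans (+-cong (sym (-‿distribˡ-* a _)) (eval∂-⊖ k p x)) (-‿+-comm _ _)

  eval∂-map : ∀ {m} (k : Fin m) (g : Term m → Term m) U V (q : Poly m) x →
    (∀ b f → evalTerm∂ k (g (b , f)) x ≈ U * evalTerm (b , f) x + V * evalTerm∂ k (b , f) x) →
    eval∂ k (List.map g q) x ≈ U * eval q x + V * eval∂ k q x
  eval∂-map k g U V []            x hyp = sym (trans (+-cong (zeroʳ _) (zeroʳ _)) (+-identityˡ _))
  eval∂-map k g U V ((b , f) ∷ q) x hyp = trans (+-cong (hyp b f) (eval∂-map k g U V q x hyp))
    (solve 6 (λ U V A B C D → (U :* A :+ V :* B) :+ (U :* C :+ V :* D) := U :* (A :+ C) :+ V :* (B :+ D)) refl _ _ _ _ _ _)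

  eval∂-⊗ : ∀ {m} (k : Fin m) (p q : Poly m) x →
    eval∂ k (p ⊗ q) x ≈ eval∂ k p x * eval q x + eval p x * eval∂ k q x
  eval∂-⊗ k []            q x = sym (trans (+-cong (zeroˡ _) (zeroˡ _)) (+-identityˡ _))
  eval∂-⊗ k ((a , e) ∷ p) q x = begin
    eval∂ k (List.map _ q ++ p ⊗ q) x
      ≈⟨ eval∂-⊕ k (List.map _ q) (p ⊗ q) x ⟩
    eval∂ k (List.map _ q) x + eval∂ k (p ⊗ q) x
      ≈⟨ +-cong (eval∂-map k _ (a * ∂monomial k e x) (a * monomial e x) q x term) (eval∂-⊗ k p q x) ⟩
    ((a * ∂e) * eval q x + (a * me) * eval∂ k q x) + (eval∂ k p x * eval q x + eval p x * eval∂ k q x)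
      ≈⟨ solve 7 (λ a De Me Dp P Q Dq →
                   ((a :* De) :* Q :+ (a :* Me) :* Dq) :+ (Dp :* Q :+ P :* Dq) :=
                   (a :* De :+ Dp) :* Q :+ (a :* Me :+ P) :* Dq)
                 refl a ∂e me (eval∂ k p x) (eval p x) (eval q x) (eval∂ k q x) ⟩
    (a * ∂e + eval∂ k p x) * eval q x + (a * me + eval p x) * eval∂ k q x ∎
    where
    ∂e me : Carrier
    ∂e = ∂monomial k e x
    me = monomial e x
    term : ∀ b f → (a * b) * ∂monomial k (zipWith ℕ._+_ e f) x
                   ≈ (a * ∂e) * (b * monomial f x) + (a * me) * (b * ∂monomial k f x)
    term b f = trans (*-congˡ (∂monomial-zip k e f x))
      (solve 6 (λ a b De Me Mf Df → (a :* b) :* (De :* Mf :+ Me :* Df) :=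
                                     (a :* De) :* (b :* Mf) :+ (a :* Me) :* (b :* Df))
             refl a b ∂e me (monomial f x) (∂monomial k f x))

  unit : ∀ {m} → Fin m → Vec ℕ m
  unit {m} j = updateAt (replicate m 0) j suc

  monomial-zero : ∀ {m} (x : Point m) → monomial (replicate m 0) x ≈ 1#
  monomial-zero []       = refl
  monomial-zero (y ∷ ys) = trans (*-identityˡ _) (monomial-zero ys)

  monomial-unit : ∀ {m} (j : Fin m) x → monomial (unit j) x ≈ lookup x j
  monomial-unit zero    (y ∷ ys) = trans (*-cong (*-identityʳ y) (monomial-zero ys)) (*-identityʳ y)
  monomial-unit (suc j) (y ∷ ys) = trans (*-identityˡ _) (monomial-unit j ys)

  ∂monomial-unit : ∀ {m} (k j : Fin m) x → ∂monomial k (unit j) x ≈ δ k j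
  ∂monomial-unit zero    zero    (y ∷ ys) =
    trans (*-cong (+-identityʳ 1#) (trans (*-identityˡ _) (monomial-zero ys))) (*-identityˡ _)
  ∂monomial-unit zero    (suc j) (y ∷ ys) = zeroˡ _
  ∂monomial-unit (suc k) zero    (y ∷ ys) =
    trans (*-congʳ (reflexive (≡.cong natK (lookup-replicate k 0)))) (zeroˡ _)
  ∂monomial-unit (suc k) (suc j) (y ∷ ys) =
    trans (∂monomial-suc k 0 (unit j) y ys) (trans (*-identityˡ _) (∂monomial-unit k j ys))

  eval-var : ∀ {m} (j : Fin m) x → eval (var j) x ≈ lookup x j
  eval-var j x = trans (+-identityʳ _) (trans (*-identityˡ _) (monomial-unit j x))

  eval∂-var : ∀ {m} (k j : Fin m) x → eval∂ k (var j) x ≈ δ k j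
  eval∂-var k j x = trans (+-identityʳ _) (trans (*-identityˡ _) (∂monomial-unit k j x))

  eval-one : ∀ {m} (x : Point m) → eval oneP x ≈ 1#
  eval-one x = trans (+-identityʳ _) (trans (*-identityˡ _) (monomial-zero x))

  eval∂-one : ∀ {m} (k : Fin m) (x : Point m) → eval∂ k oneP x ≈ 0#
  eval∂-one {m} k x = trans (+-identityʳ _)
    (trans (*-congˡ (*-congʳ (reflexive (≡.cong natK (lookup-replicate k 0)))))
           (trans (*-congˡ (zeroˡ _)) (zeroʳ _)))

  -- A coefficientwise zero polynomial evaluates to 0.  Deleting all terms with a given
  -- exponent f changes the value by coeff p f · x^f, and strictly shortens p if f occurs.

  without : ∀ {m} → Vec ℕ m → Poly m → Poly m
  without f []            = []
  without f ((b , g) ∷ p) = if does (≡-dec ℕ._≟_ g f) then without f p else (b , g) ∷ without f p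

  coeff-cons-same : ∀ {m} b (g : Vec ℕ m) p → coeff ((b , g) ∷ p) g ≈ b + coeff p g
  coeff-cons-same b g p with ≡-dec ℕ._≟_ g g
  ... | yes _  = refl
  ... | no g≢g = ⊥-elim (g≢g ≡.refl)

  coeff-cons-other : ∀ {m} b (g e : Vec ℕ m) p → g ≢ e → coeff ((b , g) ∷ p) e ≈ coeff p e
  coeff-cons-other b g e p g≢e with ≡-dec ℕ._≟_ g e
  ... | yes g≡e = ⊥-elim (g≢e g≡e)
  ... | no _    = refl

  eval-without : ∀ {m} (f : Vec ℕ m) p x → eval p x ≈ coeff p f * monomial f x + eval (without f p) x
  eval-without f []            x = sym (trans (+-identityʳ _) (zeroˡ _))
  eval-without f ((b , g) ∷ p) x with ≡-dec ℕ._≟_ g f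
  ... | yes ≡.refl = trans (+-congˡ (eval-without f p x))
    (solve 4 (λ b M c E → b :* M :+ (c :* M :+ E) := (b :+ c) :* M :+ E) refl _ _ _ _)
  ... | no _       = trans (+-congˡ (eval-without f p x))
    (solve 4 (λ bM M c E → bM :+ (c :* M :+ E) := c :* M :+ (bM :+ E)) refl _ _ _ _)

  coeff-without-same : ∀ {m} (f : Vec ℕ m) p → coeff (without f p) f ≈ 0#
  coeff-without-same f []            = refl
  coeff-without-same f ((b , g) ∷ p) with ≡-dec ℕ._≟_ g f
  ... | yes _   = coeff-without-same f p
  ... | no g≢f  = trans (coeff-cons-other b g f (without f p) g≢f) (coeff-without-same f p)

  coeff-without-other : ∀ {m} (f e : Vec ℕ m) p → e ≢ f → coeff (without f p) e ≈ coeff p e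
  coeff-without-other f e []            e≢f = refl
  coeff-without-other f e ((b , g) ∷ p) e≢f with ≡-dec ℕ._≟_ g f | ≡-dec ℕ._≟_ g e
  ... | yes ≡.refl | yes g≡e   = ⊥-elim (e≢f (≡.sym g≡e))
  ... | yes ≡.refl | no _      = coeff-without-other f e p e≢f
  ... | no _       | yes ≡.refl = trans (coeff-cons-same b e (without f p)) (+-congˡ (coeff-without-other f e p e≢f))
  ... | no _       | no g≢e    = trans (coeff-cons-other b g e (without f p) g≢e) (coeff-without-other f e p e≢f)

  length-without : ∀ {m} (f : Vec ℕ m) p → length (without f p) ℕ.≤ length p
  length-without f []            = ℕ.z≤n
  length-without f ((b , g) ∷ p) with ≡-dec ℕ._≟_ g f
  ... | yes _ = ℕₚ.m≤n⇒m≤1+n (length-without f p)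
  ... | no _  = ℕ.s≤s (length-without f p)

  eval-zero : ∀ {m} (p : Poly m) x → IsZero p → eval p x ≈ 0#
  eval-zero p x = go (length p) p ℕₚ.≤-refl
    where
    go : ∀ n p → length p ℕ.≤ n → IsZero p → eval p x ≈ 0#
    go n       []            _          _  = refl
    go (suc n) ((a , f) ∷ p) (ℕ.s≤s ≤n) p≈0 = begin
      eval ((a , f) ∷ p) x                               ≈⟨ eval-without f ((a , f) ∷ p) x ⟩
      coeff ((a , f) ∷ p) f * monomial f x + eval p' x   ≈⟨ +-cong (trans (*-congʳ (p≈0 f)) (zeroˡ _))
                                                                     (go n p' shorter p'≈0) ⟩
      0# + 0#                                            ≈⟨ +-identityʳ _ ⟩
      0#                                                 ∎
      where
      p' : Poly _
      p' = without f ((a , f) ∷ p)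
      shorter : length p' ℕ.≤ n
      shorter with ≡-dec ℕ._≟_ f f
      ... | yes _  = ℕₚ.≤-trans (length-without f p) ≤n
      ... | no f≢f = ⊥-elim (f≢f ≡.refl)
      p'≈0 : IsZero p'
      p'≈0 e with ≡-dec (ℕ._≟_) e f
      ... | yes ≡.refl = coeff-without-same f ((a , f) ∷ p)
      ... | no e≢f     = trans (coeff-without-other f e ((a , f) ∷ p) e≢f) (p≈0 e)

  coeff-⊕ : ∀ {m} (p q : Poly m) e → coeff (p ⊕ q) e ≈ coeff p e + coeff q e
  coeff-⊕ []            q e = sym (+-identityˡ _)
  coeff-⊕ ((a , g) ∷ p) q e with ≡-dec ℕ._≟_ g e
  ... | yes _ = trans (+-congˡ (coeff-⊕ p q e)) (sym (+-assoc _ _ _))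
  ... | no _  = coeff-⊕ p q e

  coeff-⊖ : ∀ {m} (p : Poly m) e → coeff (⊖ p) e ≈ - coeff p e
  coeff-⊖ []            e = sym -0#≈0#
  coeff-⊖ ((a , g) ∷ p) e with ≡-dec ℕ._≟_ g e
  ... | yes _ = trans (+-congˡ (coeff-⊖ p e)) (-‿+-comm _ _)
  ... | no _  = coeff-⊖ p e

  eval-cong : ∀ {m} (p q : Poly m) x → (∀ e → coeff p e ≈ coeff q e) → eval p x ≈ eval q x
  eval-cong p q x p≈q = begin
    eval p x                              ≈⟨ solve 2 (λ a b → a := (a :+ :- b) :+ b) refl (eval p x) (eval q x) ⟩
    (eval p x - eval q x) + eval q x      ≈⟨ +-congʳ (+-congˡ (eval-⊖ q x)) ⟨
    (eval p x + eval (⊖ q) x) + eval q x  ≈⟨ +-congʳ (eval-⊕ p (⊖ q) x) ⟨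
    eval (p ⊕ (⊖ q)) x + eval q x         ≈⟨ +-congʳ (eval-zero (p ⊕ (⊖ q)) x difference≈0) ⟩
    0# + eval q x                         ≈⟨ +-identityˡ _ ⟩
    eval q x                              ∎
    where
    difference≈0 : IsZero (p ⊕ (⊖ q))
    difference≈0 e = trans (coeff-⊕ p (⊖ q) e) (trans (+-cong (p≈q e) (coeff-⊖ q e)) (-‿inverseʳ _))

  eval-sumP : ∀ {m n} (h : Fin n → Poly m) x → eval (sumP (List.tabulate h)) x ≈ ∑[ k < n ] eval (h k) x
  eval-sumP {n = zero}  h x = refl
  eval-sumP {n = suc n} h x = trans (eval-⊕ (h zero) _ x) (+-congˡ (eval-sumP (h ∘ suc) x))

  coeff-sumP : ∀ {m n} (h : Fin n → Poly m) e → coeff (sumP (List.tabulate h)) e ≈ ∑[ k < n ] coeff (h k) e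
  coeff-sumP {n = zero}  h e = refl
  coeff-sumP {n = suc n} h e = trans (coeff-⊕ (h zero) _ e) (+-congˡ (coeff-sumP (h ∘ suc) e))

module LinearForms {c ℓ} (K : Field c ℓ) where
  open Field K hiding (zero)
  open Polynomials K
  open Evaluation K
  open FiniteSums commutativeRing
  open import Relation.Binary.Reasoning.Setoid setoid

  sum-unit : ∀ {m} (l : Fin m) → Vec.sum (unit l) ≡ 1
  sum-unit {suc m} zero    = ≡.cong suc (sum-zeros m)
    where
    sum-zeros : ∀ m → Vec.sum (replicate m 0) ≡ 0
    sum-zeros zero    = ≡.refl
    sum-zeros (suc m) = sum-zeros m
  sum-unit {suc m} (suc l) = sum-unit l

  degree-one-unit : ∀ {m} (e : Vec ℕ m) → Vec.sum e ≡ 1 → Σ (Fin m) λ l → e ≡ unit l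
  degree-one-unit (zero ∷ e) sum≡1 with degree-one-unit e sum≡1
  ... | l , ≡.refl = suc l , ≡.refl
  degree-one-unit (suc zero ∷ e) sum≡1 = zero , ≡.cong (1 ∷_) (zeros e (ℕₚ.suc-injective sum≡1))
    where
    zeros : ∀ {m} (e : Vec ℕ m) → Vec.sum e ≡ 0 → e ≡ replicate m 0
    zeros []         _    = ≡.refl
    zeros (zero ∷ e) sum≡0 = ≡.cong (0 ∷_) (zeros e sum≡0)
  degree-one-unit (suc (suc d) ∷ e) ()

  unit-injective : ∀ {m} (l l' : Fin m) → unit l ≡ unit l' → l ≡ l'
  unit-injective zero    zero     _  = ≡.refl
  unit-injective zero    (suc l') eq with ≡.cong Vec.head eq
  ... | ()
  unit-injective (suc l) zero     eq with ≡.cong Vec.head eq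
  ... | ()
  unit-injective (suc l) (suc l') eq = ≡.cong suc (unit-injective l l' (∷-injectiveʳ eq))

  linearPart : ∀ {m} → Poly m → Poly m
  linearPart p = sumP (List.tabulate (λ l → (coeff p (unit l) , unit l) ∷ []))

  coeff-linearPart : ∀ {m} (p : Poly m) → Homogeneous 1 p → ∀ e → coeff p e ≈ coeff (linearPart p) e
  coeff-linearPart {m} p homogeneous e = begin
    coeff p e                 ≈⟨ degree-split (Vec.sum e ℕ.≟ 1) ⟩
    ∑[ l < m ] single l       ≈⟨ coeff-sumP (λ l → (coeff p (unit l) , unit l) ∷ []) e ⟨
    coeff (linearPart p) e    ∎
    where
    single : ∀ l → Carrier
    single l = coeff ((coeff p (unit l) , unit l) ∷ []) e
    degree-split : Dec (Vec.sum e ≡ 1) → coeff p e ≈ ∑[ l < m ] single l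
    degree-split (yes sum≡1) with degree-one-unit e sum≡1
    ... | l , ≡.refl = sym (trans (sum-cong-≋ at-unit) (∑-δ (λ l' → coeff p (unit l')) l))
      where
      at-unit : ∀ l' → single l' ≈ coeff p (unit l') * δ l' l
      at-unit l' with l' Fin.≟ l
      ... | yes ≡.refl = trans (coeff-cons-same _ (unit l) [])
                               (trans (+-identityʳ _) (sym (trans (*-congˡ (δ-same l)) (*-identityʳ _))))
      ... | no l'≢l    = trans (coeff-cons-other _ (unit l') (unit l) [] (l'≢l ∘ unit-injective l' l))
                               (sym (trans (*-congˡ (δ-distinct l' l l'≢l)) (zeroʳ _)))
    degree-split (no sum≢1) =
      sym (trans (sum-cong-≋ off-degree) (trans (sum-replicate-zero m) (sym (homogeneous e sum≢1))))
      where
      off-degree : ∀ l → single l ≈ 0#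
      off-degree l = coeff-cons-other _ (unit l) e [] λ { ≡.refl → sum≢1 (sum-unit l) }

  eval-linear : ∀ {m} (p : Poly m) x → Homogeneous 1 p → eval p x ≈ ∑[ l < m ] (coeff p (unit l) * lookup x l)
  eval-linear {m} p x homogeneous = begin
    eval p x
      ≈⟨ eval-cong p (linearPart p) x (coeff-linearPart p homogeneous) ⟩
    eval (linearPart p) x
      ≈⟨ eval-sumP (λ l → (coeff p (unit l) , unit l) ∷ []) x ⟩
    ∑[ l < m ] (coeff p (unit l) * monomial (unit l) x + 0#)
      ≈⟨ sum-cong-≋ (λ l → trans (+-identityʳ _) (*-congˡ (monomial-unit l x))) ⟩
    ∑[ l < m ] (coeff p (unit l) * lookup x l) ∎

module FieldFacts {c ℓ} (K : Field c ℓ) where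
  open Field K
  open IntegerRingSolver K
  open import Relation.Binary.Reasoning.Setoid setoid

  cancelˡ : ∀ a b → ¬ (a ≈ 0#) → a * b ≈ 0# → b ≈ 0#
  cancelˡ a b a≉0 ab≈0 with inverse a a≉0
  ... | a⁻¹ , aa⁻¹≈1 = begin
    b                ≈⟨ *-identityˡ b ⟨
    1# * b           ≈⟨ *-congʳ aa⁻¹≈1 ⟨
    (a * a⁻¹) * b    ≈⟨ solve 3 (λ a a' b → (a :* a') :* b := a' :* (a :* b)) refl a a⁻¹ b ⟩
    a⁻¹ * (a * b)    ≈⟨ *-congˡ ab≈0 ⟩
    a⁻¹ * 0#         ≈⟨ zeroʳ a⁻¹ ⟩
    0#               ∎

  nonzero-* : ∀ a b → ¬ (a ≈ 0#) → ¬ (b ≈ 0#) → ¬ (a * b ≈ 0#)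
  nonzero-* a b a≉0 b≉0 = b≉0 ∘ cancelˡ a b a≉0

-- For factors a_e indexed by a list E, the product  ∏_e a_e  and, given "derivatives" b_e,
-- its Leibniz derivative  Σ_e b_e ∏_{e' ≠ e} a_e'.
module ProductRule {c ℓ} (K : Field c ℓ) {A : Set} (a b : A → Field.Carrier K) where
  open Field K
  open IntegerRingSolver K
  open FieldFacts K
  open Polynomials K using (natK)
  open import Relation.Binary.Reasoning.Setoid setoid

  product : List A → Carrier
  product []      = 1#
  product (e ∷ E) = a e * product E

  leibniz : List A → Carrier
  leibniz []      = 0#
  leibniz (e ∷ E) = b e * product E + a e * leibniz E

  product-nonzero : ∀ E → All (λ e → ¬ (a e ≈ 0#)) E → ¬ (product E ≈ 0#)
  product-nonzero []      []          1≈0 = 0≉1 (sym 1≈0)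
  product-nonzero (e ∷ E) (ae≉0 ∷ ≉0) = nonzero-* _ _ ae≉0 (product-nonzero E ≉0)

  product-zero : ∀ E e → e ∈ E → a e ≈ 0# → product E ≈ 0#
  product-zero (e ∷ E) e (here ≡.refl) ae≈0 = trans (*-congʳ ae≈0) (zeroˡ _)
  product-zero (_ ∷ E) e (there e∈E)   ae≈0 = trans (*-congˡ (product-zero E e e∈E ae≈0)) (zeroʳ _)

  leibniz-one-zero : ∀ E e → Unique E → e ∈ E → a e ≈ 0# →
    (∀ e' → e' ∈ E → e' ≢ e → ¬ (a e' ≈ 0#)) → leibniz E ≈ 0# → b e ≈ 0#
  leibniz-one-zero (e ∷ E) e (e∉E ∷ _) (here ≡.refl) ae≈0 others≉0 leibniz≈0 =
    cancelˡ (product E) (b e)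
      (product-nonzero E (All.tabulate λ {e'} e'∈E → others≉0 e' (there e'∈E) (distinct e'∈E)))
      (trans (*-comm _ _) (trans (sym (trans (+-congˡ (trans (*-congʳ ae≈0) (zeroˡ _))) (+-identityʳ _)))
                                 leibniz≈0))
    where
    distinct : ∀ {e'} → e' ∈ E → e' ≢ e
    distinct e'∈E ≡.refl = All.lookup e∉E e'∈E ≡.refl
  leibniz-one-zero (e' ∷ E) e (e'∉E ∷ unique) (there e∈E) ae≈0 others≉0 leibniz≈0 =
    leibniz-one-zero E e unique e∈E ae≈0 (λ e'' e''∈E → others≉0 e'' (there e''∈E))
      (cancelˡ (a e') (leibniz E) (others≉0 e' (here ≡.refl) e'≢e)
        (trans (sym (trans (+-congʳ (trans (*-congˡ (product-zero E e e∈E ae≈0)) (zeroʳ _))) (+-identityˡ _)))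
               leibniz≈0))
    where
    e'≢e : e' ≢ e
    e'≢e ≡.refl = All.lookup e'∉E e∈E ≡.refl

  leibniz-proportional : ∀ κ E → All (λ e → b e ≈ κ * a e) E →
                         leibniz E ≈ (natK (length E) * κ) * product E
  leibniz-proportional κ []      []            = sym (trans (*-congʳ (zeroˡ _)) (zeroˡ _))
  leibniz-proportional κ (e ∷ E) (be≈κae ∷ bs) = begin
    b e * product E + a e * leibniz E
      ≈⟨ +-cong (*-congʳ be≈κae) (*-congˡ (leibniz-proportional κ E bs)) ⟩
    (κ * a e) * product E + a e * ((natK (length E) * κ) * product E)
      ≈⟨ solve 4 (λ k A P N → (k :* A) :* P :+ A :* ((N :* k) :* P) := ((con (+ 1) :+ N) :* k) :* (A :* P))
                 refl κ (a e) (product E) (natK (length E)) ⟩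
    ((1# + natK (length E)) * κ) * (a e * product E) ∎

syzygyPoly : ∀ {c ℓ} (K : Field c ℓ) {m} →
             (Fin m → Polynomials.Poly K m) → Polynomials.Poly K m → Polynomials.Poly K m
syzygyPoly K {m} P F = sumP (List.map (λ k → P k ⊗ ∂ k F) (allFin m))
  where open Polynomials K

module Derivation {c ℓ} (K : Field c ℓ) {m : ℕ} (P : Fin m → Polynomials.Poly K m)
                  (x : Evaluation.Point K m) where
  open Field K hiding (zero)
  open Polynomials K
  open Evaluation K
  open FiniteSums commutativeRing
  open IntegerRingSolver K
  open import Algebra.Properties.Ring ring using (-‿distribʳ-*)
  open import Relation.Binary.Reasoning.Setoid setoid

  D : Poly m → Carrier
  D p = ∑[ k < m ] (eval (P k) x * eval∂ k p x)

  D-⊕ : ∀ p q → D (p ⊕ q) ≈ D p + D q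
  D-⊕ p q = trans (sum-cong-≋ (λ k → trans (*-congˡ (eval∂-⊕ k p q x)) (distribˡ _ _ _)))
                  (∑-distrib-+ (λ k → eval (P k) x * eval∂ k p x) (λ k → eval (P k) x * eval∂ k q x))

  D-⊖ : ∀ p → D (⊖ p) ≈ - D p
  D-⊖ p = trans (sum-cong-≋ (λ k → trans (*-congˡ (eval∂-⊖ k p x)) (sym (-‿distribʳ-* _ _))))
                (∑-distrib-neg (λ k → eval (P k) x * eval∂ k p x))

  D-⊗ : ∀ p q → D (p ⊗ q) ≈ D p * eval q x + eval p x * D q
  D-⊗ p q = begin
    ∑[ k < m ] (Pk k * eval∂ k (p ⊗ q) x)
      ≈⟨ sum-cong-≋ (λ k → trans (*-congˡ (eval∂-⊗ k p q x))
            (solve 5 (λ P dp q' p' dq → P :* (dp :* q' :+ p' :* dq) := (P :* dp) :* q' :+ p' :* (P :* dq))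
                   refl _ _ _ _ _)) ⟩
    ∑[ k < m ] ((Pk k * eval∂ k p x) * eval q x + eval p x * (Pk k * eval∂ k q x))
      ≈⟨ ∑-distrib-+ (λ k → (Pk k * eval∂ k p x) * eval q x) (λ k → eval p x * (Pk k * eval∂ k q x)) ⟩
    ∑[ k < m ] ((Pk k * eval∂ k p x) * eval q x) + ∑[ k < m ] (eval p x * (Pk k * eval∂ k q x))
      ≈⟨ +-cong (*-distribʳ-sum (eval q x) (λ k → Pk k * eval∂ k p x))
                (*-distribˡ-sum (eval p x) (λ k → Pk k * eval∂ k q x)) ⟨
    D p * eval q x + eval p x * D q ∎
    where
    Pk : Fin m → Carrier
    Pk k = eval (P k) x

  D-one : D oneP ≈ 0#
  D-one = trans (sum-cong-≋ (λ k → trans (*-congˡ (eval∂-one k x)) (zeroʳ _))) (sum-replicate-zero m)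

  D-var : ∀ j → D (var j) ≈ eval (P j) x
  D-var j = trans (sum-cong-≋ (λ k → *-congˡ (eval∂-var k j x))) (∑-δ (λ k → eval (P k) x) j)

  D-zero : D zeroP ≈ 0#
  D-zero = trans (sum-cong-≋ (λ k → zeroʳ (eval (P k) x))) (sum-replicate-zero m)

  module _ {A : Set} (φ : A → Poly m) (a b : A → Carrier)
           (eval-φ : ∀ e → eval (φ e) x ≈ a e) (D-φ : ∀ e → D (φ e) ≈ b e) where
    open ProductRule K a b

    eval-prodP : ∀ E → eval (prodP (List.map φ E)) x ≈ product E
    eval-prodP []      = eval-one x
    eval-prodP (e ∷ E) = trans (eval-⊗ (φ e) _ x) (*-cong (eval-φ e) (eval-prodP E))

    D-prodP : ∀ E → D (prodP (List.map φ E)) ≈ leibniz E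
    D-prodP []      = D-one
    D-prodP (e ∷ E) =
      trans (D-⊗ (φ e) _) (+-cong (*-cong (D-φ e) (eval-prodP E)) (*-cong (eval-φ e) (D-prodP E)))

  eval-syzygy : ∀ F → eval (syzygyPoly K P F) x ≈ D F
  eval-syzygy F = begin
    eval (syzygyPoly K P F) x
      ≡⟨ ≡.cong (λ ps → eval (sumP ps) x) (List.map-tabulate (λ k → k) (λ k → P k ⊗ ∂ k F)) ⟩
    eval (sumP (List.tabulate (λ k → P k ⊗ ∂ k F))) x
      ≈⟨ eval-sumP (λ k → P k ⊗ ∂ k F) x ⟩
    ∑[ k < m ] eval (P k ⊗ ∂ k F) x
      ≈⟨ sum-cong-≋ (λ k → trans (eval-⊗ (P k) (∂ k F) x) (*-congˡ (eval-∂ k F x))) ⟩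
    D F ∎

module GraphFacts {n : ℕ} (G : SimpleGraph n) where

  edges-unique : Unique (edges G)
  edges-unique = Unique.filter⁺ _ (Unique.cartesianProduct⁺ (Unique.allFin⁺ n) (Unique.allFin⁺ n))

  ∈-edges⁺ : ∀ i j → toℕ i < toℕ j → Adj G i j ≡ true → (i , j) ∈ edges G
  ∈-edges⁺ i j i<j i~j = ∈-filter⁺ _ (∈-cartesianProduct⁺ (∈-allFin i) (∈-allFin j))
    (Equivalence.from T-∧ (ℕₚ.<⇒<ᵇ i<j , Equivalence.from T-≡ i~j))

  ∈-edges⁻ : ∀ {i j} → (i , j) ∈ edges G → toℕ i < toℕ j × Adj G i j ≡ true
  ∈-edges⁻ {i} {j} ij∈E
    with Equivalence.to T-∧ (proj₂ (∈-filter⁻ _ {xs = List.cartesianProduct (allFin n) (allFin n)} ij∈E))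
  ... | i<ᵇj , i~j = ℕₚ.<ᵇ⇒< (toℕ i) (toℕ j) i<ᵇj , Equivalence.to T-≡ i~j

  adjacent⇒edge : ∀ a b → Adj G a b ≡ true → (a , b) ∈ edges G ⊎ (b , a) ∈ edges G
  adjacent⇒edge a b a~b with ℕₚ.<-cmp (toℕ a) (toℕ b)
  ... | tri< a<b _ _ = inj₁ (∈-edges⁺ a b a<b a~b)
  ... | tri≈ _ a≡b _ = ⊥-elim (loop (≡.subst (λ b → Adj G a b ≡ true) (≡.sym (Fin.toℕ-injective a≡b)) a~b))
    where
    loop : Adj G a a ≡ true → ⊥
    loop a~a with ≡.trans (≡.sym (irrefl G a)) a~a
    ... | ()
  ... | tri> _ _ b<a = inj₂ (∈-edges⁺ b a b<a (≡.trans (Adj-sym G b a) a~b))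

  walk-map : ∀ {S S' : Fin n → Set} → (∀ x → S x → S' x) → ∀ {a b} → Walk G S a b → Walk G S' a b
  walk-map f (here sa)         = here (f _ sa)
  walk-map f (step sa a~b w)   = step (f _ sa) a~b (walk-map f w)

  walk-start : ∀ {S : Fin n → Set} {a b} → Walk G S a b → S a
  walk-start (here sa)     = sa
  walk-start (step sa _ _) = sa

  ∉-itself : ∀ {m} (x : Fin m) p → ¬ (x ∈ₛ p ∖ x)
  ∉-itself zero    (_ ∷ p) ()
  ∉-itself (suc x) (_ ∷ p) (Vec.there x∈p∖x) = ∉-itself x p x∈p∖x

  split-at : ∀ v s {x b} → Walk G (_∈ₛ s) x b →
    Walk G (_∈ₛ s ∖ v) x b ⊎ (v ≡ b ⊎ ∃[ c ] (Adj G v c ≡ true × Walk G (_∈ₛ s ∖ v) c b))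
  split-at v s {x} (here x∈s) with x Fin.≟ v
  ... | yes ≡.refl = inj₂ (inj₁ ≡.refl)
  ... | no x≢v     = inj₁ (here (x∈p∧x≢y⇒x∈p-y x∈s x≢v))
  split-at v s {x} (step {b = y} x∈s x~y w) with split-at v s w
  ... | inj₂ later = inj₂ later
  ... | inj₁ w' with x Fin.≟ v
  ...   | yes ≡.refl = inj₂ (inj₂ (y , x~y , w'))
  ...   | no x≢v     = inj₁ (step (x∈p∧x≢y⇒x∈p-y x∈s x≢v) x~y w')

  -- (k bounds the size of s)  a walk from a ≠ b inside s exists iff some neighbour of a
  -- reaches b inside s ∖ a
  walk?-bounded : ∀ k s a b → ∣ s ∣ ≤ k → Dec (Walk G (_∈ₛ s) a b)
  walk?-bounded k s a b ∣s∣≤k with a ∈? s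
  ... | no a∉s = no (a∉s ∘ walk-start)
  ... | yes a∈s with a Fin.≟ b
  ...   | yes ≡.refl = yes (here a∈s)
  walk?-bounded zero    s a b ∣s∣≤0 | yes a∈s | no a≢b =
    ⊥-elim (ℕₚ.n≮0 (ℕₚ.<-≤-trans (x∈p⇒∣p-x∣<∣p∣ a∈s) ∣s∣≤0))
  walk?-bounded (suc k) s a b ∣s∣≤1+k | yes a∈s | no a≢b
    with Fin.any? (λ c → (Adj G a c ≟ᵇ true) ×-dec walk?-bounded k (s ∖ a) c b smaller)
    where
    smaller : ∣ s ∖ a ∣ ≤ k
    smaller = ℕₚ.≤-pred (ℕₚ.<-≤-trans (x∈p⇒∣p-x∣<∣p∣ a∈s) ∣s∣≤1+k)
  ... | yes (c , a~c , w) = yes (step a∈s a~c (walk-map (λ _ → p─q⊆p s ⁅ a ⁆) w))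
  ... | no no-neighbour   = no (impossible ∘ split-at a s)
    where
    impossible : ¬ (Walk G (_∈ₛ s ∖ a) a b ⊎ (a ≡ b ⊎ ∃[ c ] (Adj G a c ≡ true × Walk G (_∈ₛ s ∖ a) c b)))
    impossible (inj₁ w)                = ∉-itself a s (walk-start w)
    impossible (inj₂ (inj₁ a≡b))       = a≢b a≡b
    impossible (inj₂ (inj₂ neighbour)) = no-neighbour neighbour

  walk-avoiding? : ∀ v a b → Dec (Walk G (λ x → x ≢ v) a b)
  walk-avoiding? v a b with walk?-bounded ∣ ⊤ ∖ v ∣ (⊤ ∖ v) a b ℕₚ.≤-refl
  ... | yes w = yes (walk-map (λ { x x∈ ≡.refl → ∉-itself x ⊤ x∈ }) w)
  ... | no ¬w = no (¬w ∘ walk-map (λ x x≢v → x∈p∧x≢y⇒x∈p-y ∈⊤ x≢v))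

  NoCutVertex : Set
  NoCutVertex = ∀ v a b → a ≢ v → b ≢ v → Walk G (λ x → x ≢ v) a b

  -- G has a cut vertex, or none; all quantifiers range over finite sets
  cut-vertex-or-none : (∃[ v ] DisconnectedWithout G v) ⊎ NoCutVertex
  cut-vertex-or-none with Fin.any? (λ v → Fin.any? λ a → Fin.any? λ b →
                            ¬? (a Fin.≟ v) ×-dec ¬? (b Fin.≟ v) ×-dec ¬? (walk-avoiding? v a b))
  ... | yes cut  = inj₁ cut
  ... | no ¬cut  = inj₂ λ v a b a≢v b≢v → decidable-stable (walk-avoiding? v a b)
                                             (λ ¬w → ¬cut (v , a , b , a≢v , b≢v , ¬w))

bit : Bool → ℕ
bit false = 0
bit true  = 1

double : ℕ → ℕ
double zero    = zero
double (suc x) = suc (suc (double x))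

encode : ℕ → Bool → ℕ
encode x b = bit b ℕ.+ double x

decode-encode : ∀ x b → ⌊ encode x b /2⌋ ≡ x
decode-encode zero    false = ≡.refl
decode-encode zero    true  = ≡.refl
decode-encode (suc x) false = ≡.cong suc (decode-encode x false)
decode-encode (suc x) true  = ≡.cong suc (decode-encode x true)

module NoLinearSyzygy {c ℓ} (K : Field c ℓ) (charZero : Polynomials.CharZero K)
  {m : ℕ} (G : SimpleGraph (suc m)) (noCut : GraphFacts.NoCutVertex G)
  (P : Fin m → Polynomials.Poly K m) (linear : ∀ k → Polynomials.Homogeneous K 1 (P k))
  (syzygy : Polynomials.IsZero K (syzygyPoly K P (Polynomials.definingPoly K G)))
  where

  open Field K hiding (zero)
  open Polynomials K
  open Evaluation K
  open LinearForms K
  open FiniteSums commutativeRing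
  open IntegerRingSolver K
  open FieldFacts K
  open GraphFacts G
  open import Algebra.Properties.Ring ring using (+-cancelˡ)
  open import Algebra.Properties.Group +-group using (x∙y⁻¹≈ε⇒x≈y; x≈y⇒x∙y⁻¹≈ε)
  open import Relation.Binary.Reasoning.Setoid setoid

  Vertex : Set
  Vertex = Fin (suc m)

  Edge : Set
  Edge = Vertex × Vertex

  -- The point x ∈ K^m gives vertex v the coordinate X x v (vertex 0 sits at the origin);
  -- the syzygy gives it the value T x v.

  X : Point m → Vertex → Carrier
  X x zero    = 0#
  X x (suc k) = lookup x k

  T : Point m → Vertex → Carrier
  T x zero    = 0#
  T x (suc k) = eval (P k) x

  α τ : Point m → Edge → Carrier
  α x (i , j) = X x i - X x j
  τ x (i , j) = T x i - T x j

  leibniz-vanishes : ∀ x → ProductRule.leibniz K (α x) (τ x) (edges G) ≈ 0#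
  leibniz-vanishes x = begin
    leibniz (edges G)                            ≈⟨ D-prodP _ (α x) (τ x) (λ { (i , j) → eval-factor i j })
                                                              (λ { (i , j) → D-factor i j }) (edges G) ⟨
    D (definingPoly G)                           ≈⟨ eval-syzygy (definingPoly G) ⟨
    eval (syzygyPoly K P (definingPoly G)) x     ≈⟨ eval-zero (syzygyPoly K P (definingPoly G)) x syzygy ⟩
    0#                                           ∎
    where
    open ProductRule K (α x) (τ x)
    open Derivation K P x
    eval-xform : ∀ v → eval (xform v) x ≈ X x v
    eval-xform zero    = refl
    eval-xform (suc k) = eval-var k x
    D-xform : ∀ v → D (xform v) ≈ T x v
    D-xform zero    = D-zero
    D-xform (suc k) = D-var k
    eval-factor : ∀ i j → eval (xform i ⊕ (⊖ xform j)) x ≈ X x i - X x j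
    eval-factor i j =
      trans (eval-⊕ (xform i) _ x) (+-cong (eval-xform i) (trans (eval-⊖ (xform j) x) (-‿cong (eval-xform j))))
    D-factor : ∀ i j → D (xform i ⊕ (⊖ xform j)) ≈ T x i - T x j
    D-factor i j =
      trans (D-⊕ (xform i) _) (+-cong (D-xform i) (trans (D-⊖ (xform j)) (-‿cong (D-xform j))))

  -- T_v is the linear form  Σ_l R v (suc l) · u_l,  where R v w is the coefficient of
  -- the coordinate of w in T_v; Δ i j is the coefficient vector of τ_(i,j).

  R : Vertex → Vertex → Carrier
  R zero    _       = 0#
  R (suc k) zero    = 0#
  R (suc k) (suc l) = coeff (P k) (unit l)

  T-linear : ∀ x v → T x v ≈ ∑[ l < m ] (R v (suc l) * lookup x l)
  T-linear x zero    = sym (trans (sum-cong-≋ (λ l → zeroˡ (lookup x l))) (sum-replicate-zero m))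
  T-linear x (suc k) = eval-linear (P k) x (linear k)

  Δ : Vertex → Vertex → Fin m → Carrier
  Δ i j l = R i (suc l) - R j (suc l)

  τ-linear : ∀ x i j → τ x (i , j) ≈ ∑[ l < m ] (Δ i j l * lookup x l)
  τ-linear x i j = begin
    T x i - T x j
      ≈⟨ +-cong (T-linear x i) (-‿cong (T-linear x j)) ⟩
    ∑[ l < m ] (R i (suc l) * lookup x l) - ∑[ l < m ] (R j (suc l) * lookup x l)
      ≈⟨ ∑-distrib-− (λ l → R i (suc l) * lookup x l) (λ l → R j (suc l) * lookup x l) ⟨
    ∑[ l < m ] (R i (suc l) * lookup x l - R j (suc l) * lookup x l)
      ≈⟨ sum-cong-≋ (λ l → solve 3 (λ a b y → a :* y :- b :* y := (a :- b) :* y)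
                                    refl (R i (suc l)) (R j (suc l)) (lookup x l)) ⟩
    ∑[ l < m ] (Δ i j l * lookup x l) ∎

  -- Test points with natural coordinates N v; characteristic 0 makes them separate
  -- exactly the vertices that N separates.

  point : (Vertex → ℕ) → Point m
  point N = Vec.tabulate (natK ∘ N ∘ suc)

  X-point : ∀ N → N zero ≡ 0 → ∀ v → X (point N) v ≈ natK (N v)
  X-point N N0≡0 zero    = reflexive (≡.cong natK (≡.sym N0≡0))
  X-point N N0≡0 (suc l) = reflexive (Vec.lookup∘tabulate (natK ∘ N ∘ suc) l)

  natK-injective : ∀ a b → natK a ≈ natK b → a ≡ b
  natK-injective zero    zero    _   = ≡.refl
  natK-injective zero    (suc b) 0≈b = ⊥-elim (charZero b (sym 0≈b))
  natK-injective (suc a) zero    a≈0 = ⊥-elim (charZero a a≈0)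
  natK-injective (suc a) (suc b) a≈b = ≡.cong suc (natK-injective a b (+-cancelˡ 1# _ _ a≈b))

  natK-nonzero : ∀ n → 1 ≤ n → ¬ (natK n ≈ 0#)
  natK-nonzero (suc n) _ = charZero n

  α-point : ∀ N → N zero ≡ 0 → ∀ a b → α (point N) (a , b) ≈ natK (N a) - natK (N b)
  α-point N N0≡0 a b = +-cong (X-point N N0≡0 a) (-‿cong (X-point N N0≡0 b))

  α-point-zero : ∀ N → N zero ≡ 0 → ∀ a b → N a ≡ N b → α (point N) (a , b) ≈ 0#
  α-point-zero N N0≡0 a b Na≡Nb =
    trans (α-point N N0≡0 a b) (x≈y⇒x∙y⁻¹≈ε (reflexive (≡.cong natK Na≡Nb)))

  α-point-nonzero : ∀ N → N zero ≡ 0 → ∀ a b → N a ≢ N b → ¬ (α (point N) (a , b) ≈ 0#)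
  α-point-nonzero N N0≡0 a b Na≢Nb α≈0 =
    Na≢Nb (natK-injective _ _ (x∙y⁻¹≈ε⇒x≈y _ _ (trans (sym (α-point N N0≡0 a b)) α≈0)))

  τ-vanishes : ∀ i j N → (i , j) ∈ edges G → N zero ≡ 0 → N i ≡ N j →
    (∀ a b → (a , b) ∈ edges G → (a , b) ≢ (i , j) → N a ≢ N b) → τ (point N) (i , j) ≈ 0#
  τ-vanishes i j N ij∈E N0≡0 Ni≡Nj separated =
    ProductRule.leibniz-one-zero K (α x) (τ x) (edges G) (i , j) edges-unique ij∈E
      (α-point-zero N N0≡0 i j Ni≡Nj)
      (λ { (a , b) ab∈E ab≢ij → α-point-nonzero N N0≡0 a b (separated a b ab∈E ab≢ij) })
      (leibniz-vanishes x)
    where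
    x : Point m
    x = point N

  is : Vertex → Vertex → Bool
  is c w = does (w Fin.≟ c)

  is-same : ∀ c → is c c ≡ true
  is-same c = dec-true (c Fin.≟ c) ≡.refl

  is-other : ∀ c w → w ≢ c → is c w ≡ false
  is-other c w w≢c = dec-false (w Fin.≟ c) w≢c

  is-δ : ∀ (l l' : Fin m) → natK (bit (is (suc l') (suc l))) ≈ δ l l'
  is-δ l l' with l Fin.≟ l'
  ... | yes ≡.refl = trans (+-identityʳ 1#) (sym (δ-same l))
  ... | no  l≢l'   = sym (δ-distinct l l' l≢l')

  -- For any bits β on the vertices
  -- (β 0 = false), the heights  2·merge(v) + β(merge v)  identify exactly the ends of
  -- (i , j); comparing the resulting test point with the one for β = false shows
  -- that the coefficient vector Δ_(i,j) is orthogonal to  l ↦ β(merge (l+1)).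
  module Merging (i j : Vertex) (ij∈E : (i , j) ∈ edges G) where

    i<j : toℕ i < toℕ j
    i<j = proj₁ (∈-edges⁻ ij∈E)

    i≢j : i ≢ j
    i≢j i≡j = ℕₚ.<-irrefl (≡.cong toℕ i≡j) i<j

    j≢0 : j ≢ zero
    j≢0 ≡.refl = ℕₚ.n≮0 i<j

    merge : Vertex → Vertex
    merge v = if is j v then i else v

    merge-j : merge j ≡ i
    merge-j rewrite is-same j = ≡.refl

    merge-other : ∀ v → v ≢ j → merge v ≡ v
    merge-other v v≢j rewrite is-other j v v≢j = ≡.refl

    height : (Vertex → Bool) → Vertex → ℕ
    height β v = encode (toℕ (merge v)) (β (merge v))

    height-zero : ∀ β → β zero ≡ false → height β zero ≡ 0
    height-zero β β0≡false rewrite merge-other zero (j≢0 ∘ ≡.sym) | β0≡false = ≡.refl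

    height-ends : ∀ β → height β i ≡ height β j
    height-ends β rewrite merge-other i i≢j | merge-j = ≡.refl

    merge-separates : ∀ a b → toℕ a < toℕ b → (a , b) ≢ (i , j) → merge a ≢ merge b
    merge-separates a b a<b ab≢ij merged = cases (a Fin.≟ j) (b Fin.≟ j)
      where
      cases : Dec (a ≡ j) → Dec (b ≡ j) → ⊥
      cases (yes ≡.refl) (yes ≡.refl) = ℕₚ.<-irrefl ≡.refl a<b
      cases (yes ≡.refl) (no b≢j)     = ℕₚ.<-asym i<j (≡.subst (λ v → toℕ a < toℕ v) b≡i a<b)
        where
        b≡i : b ≡ i
        b≡i = ≡.trans (≡.sym (merge-other b b≢j)) (≡.trans (≡.sym merged) merge-j)
      cases (no a≢j)     (yes ≡.refl) =
        ab≢ij (≡.cong (_, b) (≡.trans (≡.sym (merge-other a a≢j)) (≡.trans merged merge-j)))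
      cases (no a≢j)     (no b≢j)     =
        ℕₚ.<-irrefl (≡.cong toℕ (≡.trans (≡.sym (merge-other a a≢j)) (≡.trans merged (merge-other b b≢j))))
                    a<b

    -- so the heights, which determine merge v, separate the ends of all other edges
    height-separates : ∀ β a b → (a , b) ∈ edges G → (a , b) ≢ (i , j) → height β a ≢ height β b
    height-separates β a b ab∈E ab≢ij same-height =
      merge-separates a b (proj₁ (∈-edges⁻ ab∈E)) ab≢ij
        (Fin.toℕ-injective (≡.trans (≡.sym (decode-encode _ (β (merge a))))
                             (≡.trans (≡.cong ⌊_/2⌋ same-height) (decode-encode _ (β (merge b))))))

    test-point : (Vertex → Bool) → Point m
    test-point β = point (height β)

    no-bits : Vertex → Bool
    no-bits _ = false

    τ-vanishes-merged : ∀ β → β zero ≡ false → τ (test-point β) (i , j) ≈ 0#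
    τ-vanishes-merged β β0≡false =
      τ-vanishes i j (height β) ij∈E (height-zero β β0≡false) (height-ends β) (height-separates β)

    coordinate-difference : ∀ β l →
      lookup (test-point β) l - lookup (test-point no-bits) l ≈ natK (bit (β (merge (suc l))))
    coordinate-difference β l = begin
      lookup (test-point β) l - lookup (test-point no-bits) l
        ≈⟨ +-cong (reflexive (Vec.lookup∘tabulate _ l)) (-‿cong (reflexive (Vec.lookup∘tabulate _ l))) ⟩
      natK (bit b ℕ.+ d) - natK d
        ≈⟨ +-congʳ (natK-+ (bit b) d) ⟩
      (natK (bit b) + natK d) - natK d
        ≈⟨ solve 2 (λ x y → (x :+ y) :- y := x) refl _ _ ⟩
      natK (bit b) ∎
      where
      b : Bool
      b = β (merge (suc l))
      d : ℕ
      d = double (toℕ (merge (suc l)))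

    -- τ_(i,j) vanishes at both test points, and is linear
    Δ-orthogonal : ∀ β → β zero ≡ false → ∑[ l < m ] (Δ i j l * natK (bit (β (merge (suc l))))) ≈ 0#
    Δ-orthogonal β β0≡false = begin
      ∑[ l < m ] (Δ i j l * natK (bit (β (merge (suc l)))))
        ≈⟨ sum-cong-≋ (λ l → *-congˡ (coordinate-difference β l)) ⟨
      ∑[ l < m ] (Δ i j l * (y l - y₀ l))
        ≈⟨ sum-cong-≋ (λ l → solve 3 (λ a u v → a :* (u :- v) := a :* u :- a :* v) refl (Δ i j l) (y l) (y₀ l))
         ⟩
      ∑[ l < m ] (Δ i j l * y l - Δ i j l * y₀ l)
        ≈⟨ ∑-distrib-− (λ l → Δ i j l * y l) (λ l → Δ i j l * y₀ l) ⟩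
      ∑[ l < m ] (Δ i j l * y l) - ∑[ l < m ] (Δ i j l * y₀ l)
        ≈⟨ +-cong (τ-linear (test-point β) i j) (-‿cong (τ-linear (test-point no-bits) i j)) ⟨
      τ (test-point β) (i , j) - τ (test-point no-bits) (i , j)
        ≈⟨ +-cong (τ-vanishes-merged β β0≡false) (-‿cong (τ-vanishes-merged no-bits ≡.refl)) ⟩
      0# - 0#
        ≈⟨ -‿inverseʳ 0# ⟩
      0# ∎
      where
      y y₀ : Fin m → Carrier
      y  = lookup (test-point β)
      y₀ = lookup (test-point no-bits)

    -- Off the ends of the edge, the columns of T_i and T_j agree (take β the indicator
    -- of the column's vertex, which merging does not move).
    columns-agree : ∀ l → suc l ≢ i → suc l ≢ j → R i (suc l) ≈ R j (suc l)
    columns-agree l l≢i l≢j = x∙y⁻¹≈ε⇒x≈y _ _ (begin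
      Δ i j l                                                ≈⟨ ∑-δ (Δ i j) l ⟨
      ∑[ l' < m ] (Δ i j l' * δ l' l)                         ≈⟨ sum-cong-≋ (λ l' → *-congˡ (bits l')) ⟨
      ∑[ l' < m ] (Δ i j l' * natK (bit (β (merge (suc l'))))) ≈⟨ Δ-orthogonal β (is-other (suc l) zero λ ()) ⟩
      0#                                                     ∎)
      where
      β : Vertex → Bool
      β = is (suc l)
      unmoved : ∀ w → Dec (w ≡ j) → β (merge w) ≡ β w
      unmoved w (yes ≡.refl) = ≡.trans (≡.cong β merge-j)
                                 (≡.trans (is-other (suc l) i (l≢i ∘ ≡.sym))
                                          (≡.sym (is-other (suc l) j (l≢j ∘ ≡.sym))))
      unmoved w (no w≢j)     = ≡.cong β (merge-other w w≢j)
      bits : ∀ l' → natK (bit (β (merge (suc l')))) ≈ δ l' l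
      bits l' = trans (reflexive (≡.cong (natK ∘ bit) (unmoved (suc l') (suc l' Fin.≟ j)))) (is-δ l' l)

    -- At the ends:  (R_ii - R_ji) + (R_ij - R_jj) = 0  (take β the indicator of i, which
    -- after merging is the indicator of {i , j}).
    ends-relation : ∀ li lj → i ≡ suc li → j ≡ suc lj → Δ i j li + Δ i j lj ≈ 0#
    ends-relation li lj ≡.refl ≡.refl = begin
      Δ i j li + Δ i j lj
        ≈⟨ +-cong (∑-δ (Δ i j) li) (∑-δ (Δ i j) lj) ⟨
      ∑[ l < m ] (Δ i j l * δ l li) + ∑[ l < m ] (Δ i j l * δ l lj)
        ≈⟨ ∑-distrib-+ (λ l → Δ i j l * δ l li) (λ l → Δ i j l * δ l lj) ⟨
      ∑[ l < m ] (Δ i j l * δ l li + Δ i j l * δ l lj)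
        ≈⟨ sum-cong-≋ (λ l → trans (sym (distribˡ _ _ _)) (*-congˡ (sym (bits l)))) ⟩
      ∑[ l < m ] (Δ i j l * natK (bit (is i (merge (suc l)))))
        ≈⟨ Δ-orthogonal (is i) (is-other i zero λ ()) ⟩
      0# ∎
      where
      split : ∀ w → Dec (w ≡ j) → natK (bit (is i (merge w))) ≈ natK (bit (is i w)) + natK (bit (is j w))
      split w (yes ≡.refl) rewrite merge-j | is-same i | is-same j | is-other i j (i≢j ∘ ≡.sym) =
        sym (+-identityˡ _)
      split w (no w≢j)     rewrite merge-other w w≢j | is-other j w w≢j =
        sym (+-identityʳ _)
      bits : ∀ l → natK (bit (is i (merge (suc l)))) ≈ δ l li + δ l lj
      bits l = trans (split (suc l) (suc l Fin.≟ j)) (+-cong (is-δ l li) (is-δ l lj))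

  columns-agree-adjacent : ∀ a b → Adj G a b ≡ true →
                           ∀ l → suc l ≢ a → suc l ≢ b → R a (suc l) ≈ R b (suc l)
  columns-agree-adjacent a b a~b l l≢a l≢b with adjacent⇒edge a b a~b
  ... | inj₁ ab∈E = Merging.columns-agree a b ab∈E l l≢a l≢b
  ... | inj₂ ba∈E = sym (Merging.columns-agree b a ba∈E l l≢b l≢a)

  column-constant : ∀ l {u w} → Walk G (λ x → x ≢ suc l) u w → R u (suc l) ≈ R w (suc l)
  column-constant l (here _)           = refl
  column-constant l (step u≢ u~v walk) =
    trans (columns-agree-adjacent _ _ u~v l (u≢ ∘ ≡.sym) (walk-start walk ∘ ≡.sym)) (column-constant l walk)

  -- ... so, G - {suc l} being connected, it vanishes off the diagonal (R 0 _ = 0).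
  off-diagonal : ∀ u l → u ≢ suc l → R u (suc l) ≈ 0#
  off-diagonal u l u≢l = column-constant l (noCut (suc l) u zero u≢l (λ ()))

  -- Along an edge between nonzero vertices the diagonal entries agree, since the
  -- off-diagonal entries in the relation at the ends vanish.
  diagonal-edge : ∀ li lj → (suc li , suc lj) ∈ edges G → R (suc li) (suc li) ≈ R (suc lj) (suc lj)
  diagonal-edge li lj ij∈E = x∙y⁻¹≈ε⇒x≈y _ _ (begin
    Rii - Rjj                ≈⟨ solve 2 (λ a b → a :- b := (a :- con (+ 0)) :+ (con (+ 0) :- b)) refl Rii Rjj ⟩
    (Rii - 0#) + (0# - Rjj)  ≈⟨ +-cong (+-congˡ (-‿cong (off-diagonal (suc lj) li (i≢j ∘ ≡.sym))))
                                       (+-congʳ (off-diagonal (suc li) lj i≢j)) ⟨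
    Δ (suc li) (suc lj) li + Δ (suc li) (suc lj) lj
                             ≈⟨ Merging.ends-relation (suc li) (suc lj) ij∈E li lj ≡.refl ≡.refl ⟩
    0#                       ∎)
    where
    open Merging (suc li) (suc lj) ij∈E using (i≢j)
    Rii Rjj : Carrier
    Rii = R (suc li) (suc li)
    Rjj = R (suc lj) (suc lj)

  diagonal-adjacent : ∀ a b → a ≢ zero → b ≢ zero → Adj G a b ≡ true → R a a ≈ R b b
  diagonal-adjacent zero     _        a≢0 _   _   = ⊥-elim (a≢0 ≡.refl)
  diagonal-adjacent (suc la) zero     _   b≢0 _   = ⊥-elim (b≢0 ≡.refl)
  diagonal-adjacent (suc la) (suc lb) _   _   a~b with adjacent⇒edge (suc la) (suc lb) a~b
  ... | inj₁ ab∈E = diagonal-edge la lb ab∈E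
  ... | inj₂ ba∈E = sym (diagonal-edge lb la ba∈E)

  -- The diagonal is constant along walks avoiding vertex 0; as G - {0} is connected,
  -- it is constant, so every T_v is the same multiple of the coordinate X_v.
  diagonal-constant : ∀ {u w} → Walk G (λ x → x ≢ zero) u w → R u u ≈ R w w
  diagonal-constant (here _)              = refl
  diagonal-constant (step u≢0 u~v walk) =
    trans (diagonal-adjacent _ _ u≢0 (walk-start walk) u~v) (diagonal-constant walk)

  R-scalar : ∀ l k l' → R (suc k) (suc l') ≈ R (suc l) (suc l) * δ l' k
  R-scalar l k l' with l' Fin.≟ k
  ... | yes ≡.refl = trans (diagonal-constant (noCut zero (suc l') (suc l) (λ ()) (λ ())))
                           (sym (trans (*-congˡ (δ-same l')) (*-identityʳ _)))
  ... | no l'≢k    = trans (off-diagonal (suc k) l' (l'≢k ∘ ≡.sym ∘ Fin.suc-injective))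
                           (sym (trans (*-congˡ (δ-distinct l' k l'≢k)) (zeroʳ _)))

  T-scalar : ∀ l x v → T x v ≈ R (suc l) (suc l) * X x v
  T-scalar l x zero    = sym (zeroʳ _)
  T-scalar l x (suc k) = begin
    T x (suc k)
      ≈⟨ T-linear x (suc k) ⟩
    ∑[ l' < m ] (R (suc k) (suc l') * lookup x l')
      ≈⟨ sum-cong-≋ (λ l' → trans (*-congʳ (R-scalar l k l'))
                                  (solve 3 (λ a d y → (a :* d) :* y := (a :* y) :* d) refl _ _ _)) ⟩
    ∑[ l' < m ] ((λ₀ * lookup x l') * δ l' k)
      ≈⟨ ∑-δ (λ l' → λ₀ * lookup x l') k ⟩
    λ₀ * lookup x k ∎
    where
    λ₀ : Carrier
    λ₀ = R (suc l) (suc l)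

  -- Euler's identity at a point where no factor vanishes then forces the common
  -- diagonal value to be 0 (here characteristic 0 and E ≠ ∅ are used).
  diagonal-zero : 1 ≤ length (edges G) → ∀ l → R (suc l) (suc l) ≈ 0#
  diagonal-zero E≢∅ l =
    cancelˡ |E| λ₀ (natK-nonzero _ E≢∅) (cancelˡ (product (edges G)) _ (product-nonzero (edges G) factors≉0) (begin
      product (edges G) * (|E| * λ₀)
        ≈⟨ *-comm _ _ ⟩
      (|E| * λ₀) * product (edges G)
        ≈⟨ leibniz-proportional λ₀ (edges G) (All.tabulate λ {e} _ → τ-scalar e) ⟨
      leibniz (edges G)
        ≈⟨ leibniz-vanishes x ⟩
      0# ∎))
    where
    λ₀ |E| : Carrier
    λ₀  = R (suc l) (suc l)
    |E| = natK (length (edges G))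
    -- a point where no factor vanishes
    x : Point m
    x = point toℕ
    open ProductRule K (α x) (τ x)
    τ-scalar : ∀ e → τ x e ≈ λ₀ * α x e
    τ-scalar (i , j) = trans (+-cong (T-scalar l x i) (-‿cong (T-scalar l x j)))
      (solve 3 (λ a u v → a :* u :- a :* v := a :* (u :- v)) refl λ₀ (X x i) (X x j))
    factors≉0 : All (λ e → ¬ (α x e ≈ 0#)) (edges G)
    factors≉0 = All.tabulate λ { {a , b} ab∈E →
      α-point-nonzero toℕ ≡.refl a b (λ a≡b → ℕₚ.<-irrefl a≡b (proj₁ (∈-edges⁻ ab∈E))) }

  all-coefficients-zero : 1 ≤ length (edges G) → ∀ k e → coeff (P k) e ≈ 0#
  all-coefficients-zero E≢∅ k e with Vec.sum e ℕ.≟ 1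
  ... | no  degree≢1 = linear k e degree≢1
  ... | yes degree≡1 with degree-one-unit e degree≡1
  ...   | l , ≡.refl with l Fin.≟ k
  ...     | yes ≡.refl = diagonal-zero E≢∅ l
  ...     | no  l≢k    = off-diagonal (suc k) l (l≢k ∘ ≡.sym ∘ Fin.suc-injective)

-- Either G has a cut vertex, and being connected is articulated, or NoLinearSyzygy
-- shows that the degree-one syzygy witnessing r(G) = 1 is zero, a contradiction.
-- (With no vertices there are no edges.)
lemma4p2 : ∀ {c ℓ} (K : Field c ℓ) → Polynomials.CharZero K →
           (n : ℕ) (G : SimpleGraph n) → Connected G → 2 ≤ length (edges G) →
           Polynomials.r[_]≡_ K G 1 → Articulated G
lemma4p2 K charZero zero    G connected () _
lemma4p2 K charZero (suc m) G connected two-edges ((P , linear , P≢0 , syzygy) , _)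
  with GraphFacts.cut-vertex-or-none G
... | inj₁ cut   = connected , cut
... | inj₂ noCut = ⊥-elim (P≢0 (NoLinearSyzygy.all-coefficients-zero K charZero G noCut P linear syzygy E≢∅))
  where
  E≢∅ : 1 ≤ length (edges G)
  E≢∅ = ℕₚ.≤-trans (s≤s z≤n) two-edges
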